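{- Let $\pi\in S_n$ have kernel shape $\rho$. Let $\widetilde G$ be a connected component of $G_\pi$ different from the component containing the entry $n$. Then all entries of $\pi$ that are vertices of $\widetilde G$ lie in one and the same feasible cell of the kernel cell decomposition of $\pi$.
   Context: Patterns. An occurrence of $132$ in $\pi\in S_n$ is a triple of positions $i<j<k$ with $\pi(i)<\pi(k)<\pi(j)$. The graph $G_\pi$. $G_\pi$ is the bipartite graph whose vertices are the entries of $\pi$ and the occurrences of $132$ in $\pi$. An entry is adjacent to an occurrence exactly when it is one of the three entries of that occurrence. Kernel. Let $\pi(i_1),\dots,\pi(i_s)$, with $i_1<\dots<i_s$, be the entries in the component of $G_\pi$ containing $n$. This subsequence is the kernel of $\pi$. The permutation $\rho\in S_s$ order-isomorphic to it is the kernel shape. Kernel cell decomposition. Set $i_0=0$, $i_{s+1}=n+1$, and interpret $\pi(i_{\rho^{ -1}(0)})$ as $0$. For $1\leq m\leq s$ and $1\leq l\leq s+1$, define $$C_{ml}(\pi)=\{\pi(j): i_{l-1}<j<i_l,\ \pi(i_{\rho^{ -1}(m-1)})<\pi(j)<\pi(i_{\rho^{ -1}(m)})\}.$$ Here $\pi(i_{\rho^{ -1}(m)})$ is the $m$-th smallest kernel entry. Feasibility. The cell $C_{ml}$ is infeasible if, in the sequence $(\rho(1),\dots,\rho(l-1),m-\tfrac12,\rho(l),\dots,\rho(s))$, the inserted entry $m-\tfrac12$ belongs to some occurrence of $132$. Equivalently, any entry of $\pi$ placed in that cell would form an occurrence of $132$ with two kernel entries. Otherwise the cell is feasible. -}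

module Defs where

open import Data.Nat using (ℕ; suc) renaming (_<_ to _<ℕ_; _≤_ to _≤ℕ_)
open import Data.Fin using (Fin; toℕ; _<_; _≤_)
open import Data.Product using (Σ; ∃; _×_; _,_)
open import Data.Sum using (_⊎_)
open import Relation.Nullary using (¬_)
open import Relation.Binary.PropositionalEquality using (_≡_)
open import Relation.Binary.Construct.Closure.ReflexiveTransitive using (Star)
open import Function.Definitions using (Injective)

-- A permutation of size n: positions Fin n, values Fin n (value v stands
-- for the entry v+1, i.e. values are 0-indexed), injective.
IsPerm : {n : ℕ} → (Fin n → Fin n) → Set
IsPerm π = Injective _≡_ _≡_ π

Occ132 : {n : ℕ} → (Fin n → Fin n) → Fin n → Fin n → Fin n → Set
Occ132 π i j k = i < j × j < k × π i < π k × π k < π j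

_∈₃_ : {n : ℕ} → Fin n → Fin n × Fin n × Fin n → Set
x ∈₃ (i , j , k) = x ≡ i ⊎ x ≡ j ⊎ x ≡ k

-- Two entries are adjacent-through-an-occurrence in G_π: there is an
-- occurrence vertex adjacent to both (a path entry – occurrence – entry).
Adj : {n : ℕ} → (Fin n → Fin n) → Fin n → Fin n → Set
Adj π x y = Σ (Fin _) λ i → Σ (Fin _) λ j → Σ (Fin _) λ k →
  Occ132 π i j k × x ∈₃ (i , j , k) × y ∈₃ (i , j , k)

Conn : {n : ℕ} → (Fin n → Fin n) → Fin n → Fin n → Set
Conn π = Star (Adj π)

InKernel : {n : ℕ} → (Fin n → Fin n) → Fin n → Fin n → Set
InKernel π np j = Conn π np j

-- e enumerates the kernel positions in increasing order: e t = i_{t+1}.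
IsKernelPosEnum : {n s : ℕ} → (Fin n → Fin n) → Fin n → (Fin s → Fin n) → Set
IsKernelPosEnum {n} {s} π np e =
  (∀ (t u : Fin s) → t < u → e t < e u) ×
  (∀ (t : Fin s) → InKernel π np (e t)) ×
  (∀ (j : Fin n) → InKernel π np j → ∃ λ t → e t ≡ j)

-- f enumerates the kernel positions in increasing order of their values:
-- f t = i_{ρ⁻¹(t+1)}, so π (f t) is the (t+1)-th smallest kernel entry.
IsKernelValEnum : {n s : ℕ} → (Fin n → Fin n) → Fin n → (Fin s → Fin n) → Set
IsKernelValEnum {n} {s} π np f =
  (∀ (t u : Fin s) → t < u → π (f t) < π (f u)) ×
  (∀ (t : Fin s) → InKernel π np (f t)) ×
  (∀ (j : Fin n) → InKernel π np j → ∃ λ t → f t ≡ j)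

-- The entry at position j lies in the cell C_{ml}, where m = M+1 and l = L+1
-- (M : Fin s, L : Fin (s+1) are 0-based indices):
--   i_{l-1} < j < i_l  (i_0 = 0, i_{s+1} = n+1 impose no constraint), and
--   (m-1)-th smallest kernel value < π j < m-th smallest kernel value
--   (the 0-th smallest being the sentinel 0, imposing no constraint).
InCell : {n s : ℕ} → (Fin n → Fin n) → (Fin s → Fin n) → (Fin s → Fin n) →
         Fin s → Fin (suc s) → Fin n → Set
InCell {n} {s} π e f M L j =
  (∀ (t : Fin s) → suc (toℕ t) ≡ toℕ L → e t < j) ×
  (∀ (t : Fin s) → toℕ t ≡ toℕ L → j < e t) ×
  (∀ (t : Fin s) → suc (toℕ t) ≡ toℕ M → π (f t) < π j) ×
  π j < π (f M)

-- Infeasibility of C_{ml}: in the sequence (ρ(1),…,ρ(l-1), m-½, ρ(l),…,ρ(s))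
-- the inserted entry m-½ belongs to an occurrence of 132 together with two
-- entries ρ(a+1), ρ(b+1) (a, b : Fin s are 0-based indices, kernel entries
-- π (e a), π (e b)).  Index a precedes the inserted entry iff toℕ a < toℕ L;
-- ρ(a+1) < m-½ iff π (e a) < π (f M).  Comparisons between ρ-values are
-- comparisons between the corresponding kernel values (order isomorphism).
Infeasible : {n s : ℕ} → (Fin n → Fin n) → (Fin s → Fin n) → (Fin s → Fin n) →
             Fin s → Fin (suc s) → Set
Infeasible {n} {s} π e f M L = Σ (Fin s) λ a → Σ (Fin s) λ b →
  -- inserted entry plays the role of "1": (m-½, ρ(a+1), ρ(b+1))
  (toℕ L ≤ℕ toℕ a × a < b × π (e b) < π (e a) × π (f M) ≤ π (e b))
  ⊎
  -- inserted entry plays the role of "3": (ρ(a+1), m-½, ρ(b+1))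
  (toℕ a <ℕ toℕ L × toℕ L ≤ℕ toℕ b × π (e a) < π (e b) × π (e b) < π (f M))
  ⊎
  -- inserted entry plays the role of "2": (ρ(a+1), ρ(b+1), m-½)
  (toℕ a <ℕ toℕ L × toℕ b <ℕ toℕ L × a < b × π (e a) < π (f M) × π (f M) ≤ π (e b))

Feasible : {n s : ℕ} → (Fin n → Fin n) → (Fin s → Fin n) → (Fin s → Fin n) →
           Fin s → Fin (suc s) → Set
Feasible π e f M L = ¬ Infeasible π e f M L

-- Fix an occurrence (i, j, k) of 132 outside the kernel. A kernel entry cannot form 132 with
-- two of its entries, and the case analysis leaves only three places for it: beyond the
-- occurrence (right of k or above j), or in one of two pockets of its cross, the union of the
-- position strip between i and k and the value strip between π i and π j. Being beyond
-- spreads through every occurrence of 132 in the kernel, and the entry n is beyond, so no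
-- kernel entry meets the cross. Hence every kernel entry lies on the same side of all three
-- entries, in position and in value, and this propagates through the whole component:
-- all its entries fall into the cell of the kernel decomposition containing any one of them.
-- That cell is feasible, since an entry in an infeasible cell forms 132 with two kernel
-- entries and would belong to the kernel.
module Submission where

open import Defs
open import Data.Nat using (ℕ; zero; suc; z≤n; s≤s; s≤s⁻¹) renaming (_<_ to _<ℕ_; _≤_ to _≤ℕ_)
import Data.Nat.Properties as ℕ
open import Data.Fin using (Fin; zero; suc; toℕ; fromℕ<; _<_; _≤_)
open import Data.Fin.Properties using (<-cmp; _<?_; toℕ<n; toℕ-fromℕ<)
open import Data.Product using (Σ; _×_; _,_; proj₁; proj₂)
open import Data.Sum as Sum using (_⊎_; inj₁; inj₂; [_,_]′)
open import Data.Empty using (⊥; ⊥-elim)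
open import Function using (_∘_; id)
open import Relation.Nullary using (¬_; yes; no)
open import Relation.Unary using (Decidable)
open import Relation.Binary using (Rel; tri<; tri≈; tri>)
open import Relation.Binary.Definitions using (_Respects_)
open import Relation.Binary.PropositionalEquality using (_≡_; _≢_; refl; sym; subst)
open import Relation.Binary.Construct.Closure.ReflexiveTransitive using (Star; ε; _◅_; _◅◅_; reverse)

respects-Star : ∀ {a r p} {A : Set a} {R : Rel A r} {P : A → Set p} →
                P Respects R → P Respects Star R
respects-Star step ε        = id
respects-Star step (r ◅ rs) = respects-Star step rs ∘ step r

Threshold : ∀ {s} → (Fin s → Set) → ℕ → Set
Threshold P ℓ = ∀ t → (toℕ t <ℕ ℓ → P t) × (P t → toℕ t <ℕ ℓ)

threshold : ∀ {s} (P : Fin s → Set) → Decidable P → (∀ {t u} → t < u → P u → P t) →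
            Σ (Fin (suc s)) λ L → Threshold P (toℕ L)
threshold {zero}  P P? down = zero , λ ()
threshold {suc s} P P? down with P? zero
... | no ¬P₀ = zero , λ t → (λ ()) , ⊥-elim ∘ ¬P₀ ∘ P-zero t
  where
  P-zero : ∀ t → P t → P zero
  P-zero zero    Pt = Pt
  P-zero (suc t) Pt = down (s≤s z≤n) Pt
... | yes P₀ with threshold (P ∘ suc) (P? ∘ suc) (λ t<u → down (s≤s t<u))
... | L , hL = suc L , λ where
  zero    → (λ _ → P₀) , λ _ → s≤s z≤n
  (suc t) → proj₁ (hL t) ∘ s≤s⁻¹ , s≤s ∘ proj₂ (hL t)

threshold-strict : ∀ {s ℓ} {P : Fin s → Set} → Threshold P ℓ → (t₀ : Fin s) → ¬ P t₀ →
              Σ (Fin s) λ M → Threshold P (toℕ M)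
threshold-strict {s} {ℓ} {P} hℓ t₀ ¬Pt₀ = fromℕ< ℓ<s , subst (Threshold P) (sym (toℕ-fromℕ< ℓ<s)) hℓ
  where
  ℓ<s : ℓ <ℕ s
  ℓ<s = ℕ.≤-<-trans (ℕ.≮⇒≥ (¬Pt₀ ∘ proj₁ (hℓ t₀))) (toℕ<n t₀)

increasing-reflects-< : ∀ {s m} {g : Fin s → Fin m} → (∀ t u → t < u → g t < g u) →
                        ∀ t u → g t < g u → t < u
increasing-reflects-< inc t u gt<gu with <-cmp t u
... | tri< t<u _ _ = t<u
... | tri≈ _ refl _ = ⊥-elim (ℕ.<-irrefl refl gt<gu)
... | tri> _ _ u<t = ⊥-elim (ℕ.<-asym gt<gu (inc u t u<t))

≢⇒<⊎> : ∀ {m} {a b : Fin m} → a ≢ b → a < b ⊎ b < a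
≢⇒<⊎> {a = a} {b} a≢b with <-cmp a b
... | tri< a<b _ _ = inj₁ a<b
... | tri≈ _ a≡b _ = ⊥-elim (a≢b a≡b)
... | tri> _ _ b<a = inj₂ b<a

SameSide : ∀ {m} → Fin m → Fin m → Fin m → Set
SameSide q t t′ = (q < t → q < t′) × (t < q → t′ < q)

SameSide-refl : ∀ {m} {q t : Fin m} → SameSide q t t
SameSide-refl = id , id

SameSide-trans : ∀ {m} {q t t′ t″ : Fin m} → SameSide q t t′ → SameSide q t′ t″ → SameSide q t t″
SameSide-trans (l , r) (l′ , r′) = l′ ∘ l , r′ ∘ r

outside-interval⇒SameSide : ∀ {m} {lo hi q t t′ : Fin m} → q ≢ lo → q ≢ hi → ¬ (lo < q × q < hi) →
                            lo ≤ t → t ≤ hi → lo ≤ t′ → t′ ≤ hi → SameSide q t t′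
outside-interval⇒SameSide {q = q} {t} {t′} q≢lo q≢hi q∉ lo≤t t≤hi lo≤t′ t′≤hi = below , above
  where
  below : q < t → q < t′
  below q<t with ≢⇒<⊎> q≢lo
  ... | inj₁ q<lo = ℕ.<-≤-trans q<lo lo≤t′
  ... | inj₂ lo<q = ⊥-elim (q∉ (lo<q , ℕ.<-≤-trans q<t t≤hi))
  above : t < q → t′ < q
  above t<q with ≢⇒<⊎> q≢hi
  ... | inj₁ q<hi = ⊥-elim (q∉ (ℕ.≤-<-trans lo≤t t<q , q<hi))
  ... | inj₂ hi<q = ℕ.≤-<-trans t′≤hi hi<q

fst∈₃ : ∀ {n} {i j k : Fin n} → i ∈₃ (i , j , k)
fst∈₃ = inj₁ refl

snd∈₃ : ∀ {n} {i j k : Fin n} → j ∈₃ (i , j , k)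
snd∈₃ = inj₂ (inj₁ refl)

thd∈₃ : ∀ {n} {i j k : Fin n} → k ∈₃ (i , j , k)
thd∈₃ = inj₂ (inj₂ refl)

module Graph {n} (π : Fin n → Fin n) where

  Adj-sym : ∀ {a b} → Adj π a b → Adj π b a
  Adj-sym (i , j , k , o , a∈ , b∈) = i , j , k , o , b∈ , a∈

  Conn-sym : ∀ {a b} → Conn π a b → Conn π b a
  Conn-sym = reverse Adj-sym

  extend : ∀ {a b c} → Conn π a b → Adj π b c → Conn π a c
  extend p q = p ◅◅ (q ◅ ε)

  occ-Adj : ∀ {i j k a b} → Occ132 π i j k → a ∈₃ (i , j , k) → b ∈₃ (i , j , k) → Adj π a b
  occ-Adj {i} {j} {k} o a∈ b∈ = i , j , k , o , a∈ , b∈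

InCross : ∀ {n} → (Fin n → Fin n) → Fin n → Fin n → Fin n → Fin n → Set
InCross π i j k z = (i < z × z < k) ⊎ (π i < π z × π z < π j)

module KernelSeparation {n} (π : Fin n → Fin n) (π-inj : IsPerm π) {r x : Fin n}
                        (r-top : ∀ z → π z ≤ π r) (r≁x : ¬ Conn π r x) where
  open Graph π

  across-≢ : ∀ {q t} → Conn π r q → Conn π x t → q ≢ t
  across-≢ cq ct refl = r≁x (cq ◅◅ Conn-sym ct)

  pos-apart : ∀ {q t} → Conn π r q → Conn π x t → q < t ⊎ t < q
  pos-apart cq ct = ≢⇒<⊎> (across-≢ cq ct)

  val-apart : ∀ {q t} → Conn π r q → Conn π x t → π q < π t ⊎ π t < π q
  val-apart cq ct = ≢⇒<⊎> (across-≢ cq ct ∘ π-inj)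

  no-occ-across : ∀ {u v w z t} → Occ132 π u v w → z ∈₃ (u , v , w) → t ∈₃ (u , v , w) →
                  Conn π r z → Conn π x t → ⊥
  no-occ-across o z∈ t∈ cz ct = across-≢ (extend cz (occ-Adj o z∈ t∈)) ct refl

  Beyond : Fin n → Fin n → Fin n → Set
  Beyond j k z = k < z ⊎ π j < π z

  beyond-mono : ∀ {j k z z′} → z < z′ → π z < π z′ → Beyond j k z → Beyond j k z′
  beyond-mono z<z′ _ (inj₁ k<z) = inj₁ (ℕ.<-trans k<z z<z′)
  beyond-mono _ πz<πz′ (inj₂ πj<πz) = inj₂ (ℕ.<-trans πj<πz πz<πz′)

  module _ {i j k : Fin n} (o : Occ132 π i j k) (ci : Conn π x i) where

    private
      i<j : i < j
      i<j = proj₁ o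

      j<k : j < k
      j<k = proj₁ (proj₂ o)

      πi<πk : π i < π k
      πi<πk = proj₁ (proj₂ (proj₂ o))

      πk<πj : π k < π j
      πk<πj = proj₂ (proj₂ (proj₂ o))

      cj : Conn π x j
      cj = extend ci (occ-Adj o fst∈₃ snd∈₃)

      ck : Conn π x k
      ck = extend ci (occ-Adj o fst∈₃ thd∈₃)

    ¬kernel-left-of-j-below-k : ∀ {z} → Conn π r z → z < j → π z < π k → ⊥
    ¬kernel-left-of-j-below-k cz z<j πz<πk =
      no-occ-across (z<j , j<k , πz<πk , πk<πj) fst∈₃ snd∈₃ cz cj

    ¬kernel-right-of-k-inside : ∀ {z} → Conn π r z → k < z → π i < π z → π z < π j → ⊥
    ¬kernel-right-of-k-inside cz k<z πi<πz πz<πj =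
      no-occ-across (i<j , ℕ.<-trans j<k k<z , πi<πz , πz<πj) thd∈₃ fst∈₃ cz ci

    ¬kernel-inside-above-i : ∀ {z} → Conn π r z → i < z → z < k → π i < π z → ⊥
    ¬kernel-inside-above-i cz i<z z<k πi<πz with pos-apart cz cj | val-apart cz ck
    ... | inj₁ z<j | inj₁ πz<πk = ¬kernel-left-of-j-below-k cz z<j πz<πk
    ... | inj₁ _   | inj₂ πk<πz = no-occ-across (i<z , z<k , πi<πk , πk<πz) snd∈₃ fst∈₃ cz ci
    ... | inj₂ j<z | _ with val-apart cz cj
    ...   | inj₁ πz<πj = no-occ-across (i<j , j<z , πi<πz , πz<πj) thd∈₃ fst∈₃ cz ci
    ...   | inj₂ πj<πz =
            no-occ-across (i<z , z<k , πi<πk , ℕ.<-trans πk<πj πj<πz) snd∈₃ fst∈₃ cz ci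

    Pocket : Fin n → Set
    Pocket z = (z < i × π k < π z × π z < π j) ⊎ (j < z × z < k × π z < π i)

    kernel-below-i⇒lower-pocket : ∀ {z} → Conn π r z → z < k → π z < π i →
                                  j < z × z < k × π z < π i
    kernel-below-i⇒lower-pocket cz z<k πz<πi with pos-apart cz cj
    ... | inj₁ z<j = ⊥-elim (¬kernel-left-of-j-below-k cz z<j (ℕ.<-trans πz<πi πi<πk))
    ... | inj₂ j<z = j<z , z<k , πz<πi

    kernel-above-i⇒left-pocket : ∀ {z} → Conn π r z → z < k → π i < π z → π z < π j →
                                 z < i × π k < π z × π z < π j
    kernel-above-i⇒left-pocket cz z<k πi<πz πz<πj with pos-apart cz ci
    ... | inj₂ i<z = ⊥-elim (¬kernel-inside-above-i cz i<z z<k πi<πz)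
    ... | inj₁ z<i with val-apart cz ck
    ...   | inj₁ πz<πk = ⊥-elim (¬kernel-left-of-j-below-k cz (ℕ.<-trans z<i i<j) πz<πk)
    ...   | inj₂ πk<πz = z<i , πk<πz , πz<πj

    kernel-placement : ∀ {z} → Conn π r z → Beyond j k z ⊎ Pocket z
    kernel-placement cz with pos-apart cz ck | val-apart cz cj
    ... | inj₂ k<z | _          = inj₁ (inj₁ k<z)
    ... | inj₁ _   | inj₂ πj<πz = inj₁ (inj₂ πj<πz)
    ... | inj₁ z<k | inj₁ πz<πj with val-apart cz ci
    ...   | inj₁ πz<πi = inj₂ (inj₂ (kernel-below-i⇒lower-pocket cz z<k πz<πi))
    ...   | inj₂ πi<πz = inj₂ (inj₁ (kernel-above-i⇒left-pocket cz z<k πi<πz πz<πj))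

    beyond⇒outside-cross : ∀ {z} → Conn π r z → Beyond j k z → ¬ InCross π i j k z
    beyond⇒outside-cross cz (inj₁ k<z) (inj₁ (_ , z<k)) = ℕ.<-asym k<z z<k
    beyond⇒outside-cross cz (inj₁ k<z) (inj₂ (πi<πz , πz<πj)) =
      ¬kernel-right-of-k-inside cz k<z πi<πz πz<πj
    beyond⇒outside-cross cz (inj₂ πj<πz) (inj₁ (i<z , z<k)) =
      ¬kernel-inside-above-i cz i<z z<k (ℕ.<-trans (ℕ.<-trans πi<πk πk<πj) πj<πz)
    beyond⇒outside-cross cz (inj₂ πj<πz) (inj₂ (_ , πz<πj)) = ℕ.<-asym πj<πz πz<πj

    left-pocket-spreads : ∀ {X Y Z} → Occ132 π X Y Z → Conn π r Y → π k < π X → π X < π j →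
                          InCross π i j k Y × InCross π i j k Z
    left-pocket-spreads {X} {Y} {Z} (X<Y , Y<Z , πX<πZ , πZ<πY) cY πk<πX πX<πj =
      spread (val-apart cY cj)
      where
      πi<πZ : π i < π Z
      πi<πZ = ℕ.<-trans πi<πk (ℕ.<-trans πk<πX πX<πZ)
      spread : π Y < π j ⊎ π j < π Y → InCross π i j k Y × InCross π i j k Z
      spread (inj₁ πY<πj) = inj₂ (ℕ.<-trans πi<πZ πZ<πY , πY<πj) ,
                            inj₂ (πi<πZ , ℕ.<-trans πZ<πY πY<πj)
      spread (inj₂ πj<πY) with pos-apart cY ci
      ... | inj₁ Y<i = ⊥-elim (no-occ-across (X<Y , ℕ.<-trans Y<i i<j , πX<πj , πj<πY)
                                             snd∈₃ thd∈₃ cY cj)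
      ... | inj₂ i<Y = ⊥-elim (no-occ-across (i<Y , Y<Z , πi<πZ , πZ<πY) snd∈₃ fst∈₃ cY ci)

    lower-pocket-spreads : ∀ {X Y Z} → Occ132 π X Y Z → Conn π r Z → j < X → X < k → π X < π i →
                           InCross π i j k Y × InCross π i j k Z
    lower-pocket-spreads {X} {Y} {Z} (X<Y , Y<Z , πX<πZ , πZ<πY) cZ j<X X<k πX<πi =
      spread (pos-apart cZ ck)
      where
      i<Y : i < Y
      i<Y = ℕ.<-trans i<j (ℕ.<-trans j<X X<Y)
      spread : Z < k ⊎ k < Z → InCross π i j k Y × InCross π i j k Z
      spread (inj₁ Z<k) = inj₁ (i<Y , ℕ.<-trans Y<Z Z<k) , inj₁ (ℕ.<-trans i<Y Y<Z , Z<k)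
      spread (inj₂ k<Z) with val-apart cZ ck
      ... | inj₁ πZ<πk = ⊥-elim (no-occ-across (X<k , k<Z , πX<πZ , πZ<πk) thd∈₃ snd∈₃ cZ ck)
      ... | inj₂ πk<πZ =
            ⊥-elim (no-occ-across (i<Y , Y<Z , ℕ.<-trans πi<πk πk<πZ , πZ<πY) thd∈₃ fst∈₃ cZ ci)

    pocket-spreads : ∀ {X Y Z} → Occ132 π X Y Z → Conn π r X → Pocket X →
                     InCross π i j k Y × InCross π i j k Z
    pocket-spreads o cX (inj₁ (_ , πk<πX , πX<πj)) =
      left-pocket-spreads o (extend cX (occ-Adj o fst∈₃ snd∈₃)) πk<πX πX<πj
    pocket-spreads o cX (inj₂ (j<X , X<k , πX<πi)) =
      lower-pocket-spreads o (extend cX (occ-Adj o fst∈₃ thd∈₃)) j<X X<k πX<πi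

    beyond-along-occ : ∀ {X Y Z u v} → Occ132 π X Y Z → Conn π r X →
                       u ∈₃ (X , Y , Z) → v ∈₃ (X , Y , Z) → Beyond j k u → Beyond j k v
    beyond-along-occ {X} {Y} {Z} o@(X<Y , Y<Z , πX<πZ , πZ<πY) cX u∈ v∈ =
      from-first v∈ ∘ to-first u∈
      where
      X-beyond-or-YZ-in-cross : Beyond j k X ⊎ (InCross π i j k Y × InCross π i j k Z)
      X-beyond-or-YZ-in-cross = Sum.map₂ (pocket-spreads o cX) (kernel-placement cX)
      to-first : ∀ {w} → w ∈₃ (X , Y , Z) → Beyond j k w → Beyond j k X
      to-first (inj₁ refl) bX = bX
      to-first (inj₂ (inj₁ refl)) bY =
        [ id , ⊥-elim ∘ beyond⇒outside-cross (extend cX (occ-Adj o fst∈₃ snd∈₃)) bY ∘ proj₁ ]′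
        X-beyond-or-YZ-in-cross
      to-first (inj₂ (inj₂ refl)) bZ =
        [ id , ⊥-elim ∘ beyond⇒outside-cross (extend cX (occ-Adj o fst∈₃ thd∈₃)) bZ ∘ proj₂ ]′
        X-beyond-or-YZ-in-cross
      from-first : ∀ {w} → w ∈₃ (X , Y , Z) → Beyond j k X → Beyond j k w
      from-first (inj₁ refl)        = id
      from-first (inj₂ (inj₁ refl)) = beyond-mono X<Y (ℕ.<-trans πX<πZ πZ<πY)
      from-first (inj₂ (inj₂ refl)) = beyond-mono (ℕ.<-trans X<Y Y<Z) πX<πZ

    kernel-beyond : ∀ {q} → Conn π r q → Beyond j k q
    kernel-beyond cq = proj₂ (respects-Star step cq (ε , r-beyond))
      where
      r-beyond : Beyond j k r
      r-beyond with val-apart ε cj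
      ... | inj₁ πr<πj = ⊥-elim (ℕ.<⇒≱ πr<πj (r-top j))
      ... | inj₂ πj<πr = inj₂ πj<πr
      step : (λ u → Conn π r u × Beyond j k u) Respects Adj π
      step adj@(_ , _ , _ , o′ , u∈ , v∈) (cu , bu) =
        extend cu adj , beyond-along-occ o′ (extend cu (occ-Adj o′ u∈ fst∈₃)) u∈ v∈ bu

    kernel-outside-cross : ∀ {q} → Conn π r q → ¬ InCross π i j k q
    kernel-outside-cross cq = beyond⇒outside-cross cq (kernel-beyond cq)

    occ-span : ∀ {t} → t ∈₃ (i , j , k) → (i ≤ t × t ≤ k) × (π i ≤ π t × π t ≤ π j)
    occ-span (inj₁ refl)        = (ℕ.≤-refl , ℕ.<⇒≤ (ℕ.<-trans i<j j<k)) ,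
                                  (ℕ.≤-refl , ℕ.<⇒≤ (ℕ.<-trans πi<πk πk<πj))
    occ-span (inj₂ (inj₁ refl)) = (ℕ.<⇒≤ i<j , ℕ.<⇒≤ j<k) ,
                                  (ℕ.<⇒≤ (ℕ.<-trans πi<πk πk<πj) , ℕ.≤-refl)
    occ-span (inj₂ (inj₂ refl)) = (ℕ.<⇒≤ (ℕ.<-trans i<j j<k) , ℕ.≤-refl) ,
                                  (ℕ.<⇒≤ πi<πk , ℕ.<⇒≤ πk<πj)

    kernel-SameSide-occ : ∀ {q t t′} → Conn π r q → t ∈₃ (i , j , k) → t′ ∈₃ (i , j , k) →
                          SameSide q t t′ × SameSide (π q) (π t) (π t′)
    kernel-SameSide-occ cq t∈ t′∈
      with occ-span t∈ | occ-span t′∈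
    ... | (i≤t , t≤k) , (πi≤πt , πt≤πj) | (i≤t′ , t′≤k) , (πi≤πt′ , πt′≤πj) =
      outside-interval⇒SameSide (across-≢ cq ci) (across-≢ cq ck) (kernel-outside-cross cq ∘ inj₁)
                                i≤t t≤k i≤t′ t′≤k ,
      outside-interval⇒SameSide (across-≢ cq ci ∘ π-inj) (across-≢ cq cj ∘ π-inj)
                                (kernel-outside-cross cq ∘ inj₂) πi≤πt πt≤πj πi≤πt′ πt′≤πj

  Aligned : Fin n → Fin n → Set
  Aligned t t′ = ∀ q → Conn π r q → SameSide q t t′ × SameSide (π q) (π t) (π t′)

  component-aligned : ∀ {y} → Conn π x y → Aligned x y
  component-aligned cy = proj₂ (respects-Star step cy (ε , λ _ _ → SameSide-refl , SameSide-refl))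
    where
    step : (λ u → Conn π x u × Aligned x u) Respects Adj π
    step adj@(_ , _ , _ , o , u∈ , v∈) (cu , x≈u) = extend cu adj , λ q cq →
      let pos , val = x≈u q cq
          pos′ , val′ = kernel-SameSide-occ o (extend cu (occ-Adj o u∈ fst∈₃)) cq u∈ v∈
      in SameSide-trans pos pos′ , SameSide-trans val val′

module KernelCell {n s} (π : Fin n → Fin n) (π-inj : IsPerm π) {np x : Fin n}
                  (np-top : ∀ z → π z ≤ π np) (np≁x : ¬ Conn π np x) {e f : Fin s → Fin n}
                  (e-enum : IsKernelPosEnum π np e) (f-enum : IsKernelValEnum π np f) where
  open KernelSeparation π π-inj np-top np≁x

  e-increasing : ∀ t u → t < u → e t < e u
  e-increasing = proj₁ e-enum

  e-kernel : ∀ t → Conn π np (e t)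
  e-kernel = proj₁ (proj₂ e-enum)

  f-increasing : ∀ t u → t < u → π (f t) < π (f u)
  f-increasing = proj₁ f-enum

  f-kernel : ∀ t → Conn π np (f t)
  f-kernel = proj₁ (proj₂ f-enum)

  f-onto : ∀ q → Conn π np q → Σ (Fin s) λ t → f t ≡ q
  f-onto = proj₂ (proj₂ f-enum)

  L-threshold : Σ (Fin (suc s)) λ L → Threshold (λ t → e t < x) (toℕ L)
  L-threshold = threshold (λ t → e t < x) (λ t → e t <? x)
                          (λ {t} {u} t<u → ℕ.<-trans (e-increasing t u t<u))

  L : Fin (suc s)
  L = proj₁ L-threshold

  before-L : ∀ t → toℕ t <ℕ toℕ L → e t < x
  before-L t = proj₁ (proj₂ L-threshold t)

  after-L : ∀ t → toℕ L ≤ℕ toℕ t → x < e t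
  after-L t L≤t with pos-apart (e-kernel t) ε
  ... | inj₁ et<x = ⊥-elim (ℕ.≤⇒≯ L≤t (proj₂ (proj₂ L-threshold t) et<x))
  ... | inj₂ x<et = x<et

  M-threshold : Σ (Fin s) λ M → Threshold (λ t → π (f t) < π x) (toℕ M)
  M-threshold = threshold-strict (proj₂ (threshold (λ t → π (f t) < π x) (λ t → π (f t) <? π x)
                                              (λ {t} {u} t<u → ℕ.<-trans (f-increasing t u t<u))))
                            t-np ¬πnp<πx
    where
    t-np : Fin s
    t-np = proj₁ (f-onto np ε)
    ¬πnp<πx : ¬ (π (f t-np) < π x)
    ¬πnp<πx rewrite proj₂ (f-onto np ε) = ℕ.≤⇒≯ (np-top x)

  M : Fin s
  M = proj₁ M-threshold

  below-M : ∀ t → toℕ t <ℕ toℕ M → π (f t) < π x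
  below-M t = proj₁ (proj₂ M-threshold t)

  above-M : π x < π (f M)
  above-M with val-apart (f-kernel M) ε
  ... | inj₁ πfM<πx = ⊥-elim (ℕ.<-irrefl refl (proj₂ (proj₂ M-threshold M) πfM<πx))
  ... | inj₂ πx<πfM = πx<πfM

  kernel-below-M : ∀ {q} → Conn π np q → π q < π (f M) → π q < π x
  kernel-below-M cq with f-onto _ cq
  ... | t , refl = below-M t ∘ increasing-reflects-< f-increasing t M

  feasible : Feasible π e f M L
  feasible (a , b , inj₁ (L≤a , a<b , πeb<πea , πfM≤πeb)) =
    no-occ-across (after-L a L≤a , e-increasing a b a<b , ℕ.<-≤-trans above-M πfM≤πeb , πeb<πea)
                  snd∈₃ fst∈₃ (e-kernel a) ε
  feasible (a , b , inj₂ (inj₁ (a<L , L≤b , πea<πeb , πeb<πfM))) =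
    no-occ-across (before-L a a<L , after-L b L≤b , πea<πeb , kernel-below-M (e-kernel b) πeb<πfM)
                  fst∈₃ snd∈₃ (e-kernel a) ε
  feasible (a , b , inj₂ (inj₂ (a<L , b<L , a<b , πea<πfM , πfM≤πeb))) =
    no-occ-across (e-increasing a b a<b , before-L b b<L , kernel-below-M (e-kernel a) πea<πfM ,
                   ℕ.<-≤-trans above-M πfM≤πeb)
                  fst∈₃ thd∈₃ (e-kernel a) ε

  component-in-cell : ∀ {y} → Conn π x y → InCell π e f M L y
  component-in-cell {y} cy =
    (λ t 1+t≡L → proj₁ (pos (e-kernel t)) (before-L t (subst (toℕ t <ℕ_) 1+t≡L (ℕ.n<1+n _)))) ,
    (λ t t≡L → proj₂ (pos (e-kernel t)) (after-L t (ℕ.≤-reflexive (sym t≡L)))) ,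
    (λ t 1+t≡M → proj₁ (val (f-kernel t)) (below-M t (subst (toℕ t <ℕ_) 1+t≡M (ℕ.n<1+n _)))) ,
    proj₂ (val (f-kernel M)) above-M
    where
    pos : ∀ {q} → Conn π np q → SameSide q x y
    pos cq = proj₁ (component-aligned cy _ cq)
    val : ∀ {q} → Conn π np q → SameSide (π q) (π x) (π y)
    val cq = proj₂ (component-aligned cy _ cq)

theorem2 : (n : ℕ) (π : Fin n → Fin n) → IsPerm π →
           (np : Fin n) → suc (toℕ (π np)) ≡ n →
           (s : ℕ) (e f : Fin s → Fin n) →
           IsKernelPosEnum π np e → IsKernelValEnum π np f →
           (x : Fin n) → ¬ Conn π np x →
           Σ (Fin s) λ M → Σ (Fin (suc s)) λ L →
             Feasible π e f M L × ((y : Fin n) → Conn π x y → InCell π e f M L y)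
theorem2 n π π-inj np np-max s e f e-enum f-enum x np≁x =
  M , L , feasible , λ _ → component-in-cell
  where
  np-top : ∀ z → π z ≤ π np
  np-top z = s≤s⁻¹ (subst (toℕ (π z) <ℕ_) (sym np-max) (toℕ<n (π z)))
  open KernelCell π π-inj np-top np≁x e-enum f-enum
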